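{- Let $\mathcal{O}$ be an annotated $\mathcal{ELH}^r$ ontology in normal form satisfying condition $(\ast)$ below, and let $\mathcal{I}_\mathcal{O}$ be its canonical model constructed below. Then $\mathcal{I}_\mathcal{O}$ is a model of $\mathcal{O}$.
   Context: Fix pairwise disjoint countably infinite sets $N_C$, $N_R$, $N_I$, $N_V$ (concept, role, individual names, provenance variables). Monomials: finite products of variables (empty product $1$), $N_M$ their set, computed in the Trio semiring ($\times$ commutative, associative, idempotent), so $m\approx n$ iff $m,n$ contain the same variables; $[m]$ is the product of the distinct variables of $m$ in lexicographic order, $N_{[M]}=\{[m]\mid m\in N_M\}$. $\mathcal{ELH}^r$ concepts $C::=A\mid\exists R.C\mid C\sqcap C\mid\top$; axioms: GCIs $C\sqsubseteq D$ with $D::=A\mid\exists R$, role inclusions $R\sqsubseteq S$, range restrictions ${\sf ran}(R)\sqsubseteq A$, assertions $A(a)$, $R(a,b)$. Annotated ontology: finite set of $(\alpha,v)$, $v\in N_V\cup\{1\}$; normal form: every GCI is $A\sqsubseteq B$, $A\sqcap A'\sqsubseteq B$, $A\sqsubseteq\exists R$ or $\exists R.A\sqsubseteq B$, $A,A'\in N_C\cup\{\top\}$, $B\in N_C$. Semantics: annotated interpretation $\mathcal{I}$ with domain $\Delta^\mathcal{I}$, disjoint monomial domain $\Delta^\mathcal{I}_m$, $a^\mathcal{I}\in\Delta^\mathcal{I}$, $A^\mathcal{I}\subseteq\Delta^\mathcal{I}\times\Delta^\mathcal{I}_m$, $R^\mathcal{I}\subseteq\Delta^\mathcal{I}\times\Delta^\mathcal{I}\times\Delta^\mathcal{I}_m$,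 $m^\mathcal{I}\in\Delta^\mathcal{I}_m$ with $m^\mathcal{I}=n^\mathcal{I}$ iff $m\approx n$; $\top^\mathcal{I}=\Delta^\mathcal{I}\times\{1^\mathcal{I}\}$, $(\exists R)^\mathcal{I}=\{(d,\mu)\mid\exists e\,(d,e,\mu)\in R^\mathcal{I}\}$, $({\sf ran}(R))^\mathcal{I}=\{(e,\mu)\mid\exists d\,(d,e,\mu)\in R^\mathcal{I}\}$, $(C\sqcap D)^\mathcal{I}=\{(d,(m\times n)^\mathcal{I})\mid(d,m^\mathcal{I})\in C^\mathcal{I},(d,n^\mathcal{I})\in D^\mathcal{I}\}$, $(\exists R.C)^\mathcal{I}=\{(d,(m\times n)^\mathcal{I})\mid\exists e\,(d,e,m^\mathcal{I})\in R^\mathcal{I},(e,n^\mathcal{I})\in C^\mathcal{I}\}$; satisfaction of $(R\sqsubseteq S,m)$: $(d,e,n^\mathcal{I})\in R^\mathcal{I}\Rightarrow(d,e,(m\times n)^\mathcal{I})\in S^\mathcal{I}$ for all $n$; of $(G\sqsubseteq D,m)$: $(d,n^\mathcal{I})\in G^\mathcal{I}\Rightarrow(d,(m\times n)^\mathcal{I})\in D^\mathcal{I}$ for all $n$; of $(A(a),m)$: $(a^\mathcal{I},m^\mathcal{I})\in A^\mathcal{I}$; of $(R(a,b),m)$: $(a^\mathcal{I},b^\mathcal{I},m^\mathcal{I})\in R^\mathcal{I}$. $\mathcal{O}\models(\alpha,m)$ iff all models of $\mathcal{O}$ satisfy it. Condition $(\ast)$: whenever $\mathcal{O}\models({\sf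 ran}(R)\sqsubseteq B,n)$ for some $B\in N_C$, $R\in N_R$, $n\in N_M$, then $({\sf ran}(R)\sqsubseteq B,[n])\in\mathcal{O}$. Canonical model: let ${\sf Ind}(\mathcal{O})$ be the individual names in $\mathcal{O}$, ${\sf Rol}(\mathcal{O})$ the role names in $\mathcal{O}$, $M(\mathcal{O})$ the set of representatives of monomials built from variables occurring in $\mathcal{O}$, and ${\sf Aux}(\mathcal{O})=\{d^m_R\mid R\in{\sf Rol}(\mathcal{O}),m\in M(\mathcal{O})\}$ a set of fresh elements disjoint from ${\sf Ind}(\mathcal{O})$. Set $\Delta^{\mathcal{I}_\mathcal{O}}={\sf Ind}(\mathcal{O})\cup{\sf Aux}(\mathcal{O})$ and $\Delta^{\mathcal{I}_\mathcal{O}}_m=N_{[M]}$. $\mathcal{I}^0_\mathcal{O}$: $a\mapsto a$ for $a\in{\sf Ind}(\mathcal{O})$ (other individual names mapped arbitrarily), $m\mapsto[m]$, $A^{\mathcal{I}^0_\mathcal{O}}=\{(a,[m])\mid\mathcal{O}\models(A(a),m)\}$, $R^{\mathcal{I}^0_\mathcal{O}}=\{(a,b,[m])\mid\mathcal{O}\models(R(a,b),m)\}$. $\mathcal{I}^{i+1}_\mathcal{O}$ is obtained from $\mathcal{I}^i_\mathcal{O}$ by choosing an annotated axiom $\alpha\in\mathcal{O}$ and applying one of the following rules, in a fair way (every applicable rule is eventually applied): R1: if $\alpha=(C\sqsubseteq A,m)$ ($C$ a concept or ${\sf ran}(R)$) and $(d,[n])\in C^{\mathcal{I}^i_\mathcal{O}}$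 with $n\in M(\mathcal{O})$, add $(d,[m\times n])$ to $A$; R2: if $\alpha=(C\sqsubseteq\exists R,m)$ and $(d,[n])\in C^{\mathcal{I}^i_\mathcal{O}}$ with $n\in M(\mathcal{O})$, add $(d,d^{[m\times n]}_R,[m\times n])$ to $R$; R3: if $\alpha=(R\sqsubseteq S,m)$ and $(d,d',[n])\in R^{\mathcal{I}^i_\mathcal{O}}$ with $n\in M(\mathcal{O})$, add $(d,d',[m\times n])$ to $S$. The interpretation function of $\mathcal{I}_\mathcal{O}$ is the union of those of all $\mathcal{I}^i_\mathcal{O}$. -}

module Defs where

open import Level using (Level; 0ℓ; Lift) renaming (suc to lsuc)
open import Data.Bool using (Bool; true; false; T; _∧_; not; if_then_else_)
open import Data.Unit using (⊤; tt)
open import Data.Empty using (⊥)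
open import Data.Nat using (ℕ; zero; suc; _<ᵇ_; _≡ᵇ_)
open import Data.Fin using (Fin)
open import Data.Maybe using (Maybe; just; nothing)
open import Data.List using (List; []; _∷_; _++_; length; lookup; mapMaybe; foldr; concatMap)
open import Data.Bool.ListAction using (any; all)
open import Data.List.Membership.Propositional using (_∈_)
open import Data.Product using (Σ; _×_; _,_; proj₁; proj₂; ∃)
open import Data.Sum using (_⊎_; inj₁; inj₂)
open import Relation.Binary.PropositionalEquality using (_≡_; refl)
open import Function.Bundles using (_⇔_)

ConceptName RoleName IndName Var : Set
ConceptName = ℕ
RoleName    = ℕ
IndName     = ℕ
Var         = ℕ

-- Monomials (Trio semiring, idempotent ×): a finite product of
-- variables, i.e. a list of variables; 1 is the empty list, × is ++.

Mon : Set
Mon = List Var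

𝟙 : Mon
𝟙 = []

_⊗_ : Mon → Mon → Mon
m ⊗ n = m ++ n

_≈ₘ_ : Mon → Mon → Set
m ≈ₘ n = ∀ (x : Var) → (x ∈ m) ⇔ (x ∈ n)

-- [m]: product of the distinct variables of m in increasing order,
-- i.e. the strictly increasing list of the variables of m.
isCanon : List ℕ → Bool
isCanon []              = true
isCanon (x ∷ [])        = true
isCanon (x ∷ y ∷ r)     = (x <ᵇ y) ∧ isCanon (y ∷ r)

mutual
  ins : ℕ → List ℕ → List ℕ
  ins x []      = x ∷ []
  ins x (y ∷ r) = ins′ (x <ᵇ y) (x ≡ᵇ y) x y r

  ins′ : Bool → Bool → ℕ → ℕ → List ℕ → List ℕ
  ins′ true  _     x y r = x ∷ y ∷ r
  ins′ false true  x y r = y ∷ r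
  ins′ false false x y r = y ∷ ins x r

norm : Mon → List ℕ
norm = foldr ins []

private
  tri : ∀ x y → T (not (x <ᵇ y)) → T (not (x ≡ᵇ y)) → T (y <ᵇ x)
  tri zero    zero    _ ()
  tri zero    (suc y) () _
  tri (suc x) zero    _ _ = tt
  tri (suc x) (suc y) p q = tri x y p q

  split∧ : ∀ {a b} → T (a ∧ b) → T a × T b
  split∧ {true} {true} _ = tt , tt

  mk∧ : ∀ {a b} → T a → T b → T (a ∧ b)
  mk∧ {true} {true} _ _ = tt

  insTail : ∀ x y r → T (y <ᵇ x) → T (isCanon (y ∷ r)) → T (isCanon (y ∷ ins x r))
  insTail x y []      yx _ = mk∧ yx tt
  insTail x y (z ∷ r) yx c = go (x <ᵇ z) (x ≡ᵇ z) refl refl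
    where
      yz = proj₁ (split∧ {y <ᵇ z} c)
      cz = proj₂ (split∧ {y <ᵇ z} c)
      go : ∀ b1 b2 → (x <ᵇ z) ≡ b1 → (x ≡ᵇ z) ≡ b2
         → T (isCanon (y ∷ ins′ b1 b2 x z r))
      go true  _     e1 _  = mk∧ yx (mk∧ (subst′ e1) cz)
        where subst′ : (x <ᵇ z) ≡ true → T (x <ᵇ z)
              subst′ e rewrite e = tt
      go false true  _  _  = c
      go false false e1 e2 = mk∧ yz (insTail x z r (tri x z (n1 e1) (n2 e2)) cz)
        where n1 : (x <ᵇ z) ≡ false → T (not (x <ᵇ z))
              n1 e rewrite e = tt
              n2 : (x ≡ᵇ z) ≡ false → T (not (x ≡ᵇ z))
              n2 e rewrite e = tt

  insCanon : ∀ x r → T (isCanon r) → T (isCanon (ins x r))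
  insCanon x []      _ = tt
  insCanon x (y ∷ r) c = go (x <ᵇ y) (x ≡ᵇ y) refl refl
    where
      go : ∀ b1 b2 → (x <ᵇ y) ≡ b1 → (x ≡ᵇ y) ≡ b2
         → T (isCanon (ins′ b1 b2 x y r))
      go true  _     e1 _  = mk∧ (s e1) c
        where s : (x <ᵇ y) ≡ true → T (x <ᵇ y)
              s e rewrite e = tt
      go false true  _  _  = c
      go false false e1 e2 = insTail x y r (tri x y (n1 e1) (n2 e2)) c
        where n1 : (x <ᵇ y) ≡ false → T (not (x <ᵇ y))
              n1 e rewrite e = tt
              n2 : (x ≡ᵇ y) ≡ false → T (not (x ≡ᵇ y))
              n2 e rewrite e = tt

normCanon : ∀ m → T (isCanon (norm m))
normCanon []      = tt
normCanon (x ∷ m) = insCanon x (norm m) (normCanon m)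

NM : Set
NM = Σ (List ℕ) (λ r → T (isCanon r))

[_] : Mon → NM
[ m ] = norm m , normCanon m

data Concept : Set where
  atom : ConceptName → Concept
  top  : Concept
  ex   : RoleName → Concept → Concept
  and  : Concept → Concept → Concept

data RHS : Set where
  atomR : ConceptName → RHS
  exR   : RoleName → RHS

data Axiom : Set where
  gci  : Concept → RHS → Axiom
  rinc : RoleName → RoleName → Axiom
  ran  : RoleName → ConceptName → Axiom
  cass : ConceptName → IndName → Axiom
  rass : RoleName → IndName → IndName → Axiom

-- annotation v ∈ N_V ∪ {1}: nothing stands for 1
Annot : Set
Annot = Maybe Var

annot : Annot → Mon
annot nothing  = 𝟙
annot (just v) = v ∷ []

Ontology : Set
Ontology = List (Axiom × Annot)

data Basic : Concept → Set where
  basic-atom : ∀ A → Basic (atom A)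
  basic-top  : Basic top

data NormalAx : Axiom → Set where
  nf-sub  : ∀ {C} B → Basic C → NormalAx (gci C (atomR B))
  nf-and  : ∀ {C C′} B → Basic C → Basic C′ → NormalAx (gci (and C C′) (atomR B))
  nf-ex   : ∀ {C} R → Basic C → NormalAx (gci C (exR R))
  nf-exl  : ∀ {C} R B → Basic C → NormalAx (gci (ex R C) (atomR B))
  nf-rinc : ∀ R S → NormalAx (rinc R S)
  nf-ran  : ∀ R A → NormalAx (ran R A)
  nf-cass : ∀ A a → NormalAx (cass A a)
  nf-rass : ∀ R a b → NormalAx (rass R a b)

NormalForm : Ontology → Set
NormalForm O = ∀ {x} → x ∈ O → NormalAx (proj₁ x)

-- Semantics: annotated interpretations.
-- A structure without the monomial law; the law m^I = n^I ⇔ m ≈ n is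
-- stated separately (MonLaw).  Predicates live in Set ℓ.

record Structure (ℓ : Level) : Set (lsuc ℓ) where
  field
    Δ    : Set
    Δm   : Set
    ind  : IndName → Δ
    mon  : Mon → Δm
    conc : ConceptName → Δ → Δm → Set ℓ
    role : RoleName → Δ → Δ → Δm → Set ℓ

MonLaw : ∀ {ℓ} → Structure ℓ → Set
MonLaw S = ∀ m n → (mon m ≡ mon n) ⇔ (m ≈ₘ n)
  where open Structure S

module Sem {ℓ : Level} (S : Structure ℓ) where
  open Structure S

  ⟦_⟧ : Concept → Δ → Δm → Set ℓ
  ⟦ atom A ⟧  d μ = conc A d μ
  ⟦ top ⟧     d μ = Lift ℓ (μ ≡ mon 𝟙)
  ⟦ and C D ⟧ d μ = Σ Mon λ m → Σ Mon λ n →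
                      ⟦ C ⟧ d (mon m) × ⟦ D ⟧ d (mon n) × Lift ℓ (μ ≡ mon (m ⊗ n))
  ⟦ ex R C ⟧  d μ = Σ Δ λ e → Σ Mon λ m → Σ Mon λ n →
                      role R d e (mon m) × ⟦ C ⟧ e (mon n) × Lift ℓ (μ ≡ mon (m ⊗ n))

  ⟦_⟧ʳ : RHS → Δ → Δm → Set ℓ
  ⟦ atomR A ⟧ʳ d μ = conc A d μ
  ⟦ exR R ⟧ʳ   d μ = Σ Δ λ e → role R d e μ

  ranSem : RoleName → Δ → Δm → Set ℓ
  ranSem R e μ = Σ Δ λ d → role R d e μ

  Sat : Axiom → Mon → Set ℓ
  Sat (gci C D)    m = ∀ d n → ⟦ C ⟧ d (mon n) → ⟦ D ⟧ʳ d (mon (m ⊗ n))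
  Sat (rinc R S′)  m = ∀ d e n → role R d e (mon n) → role S′ d e (mon (m ⊗ n))
  Sat (ran R A)    m = ∀ e n → ranSem R e (mon n) → conc A e (mon (m ⊗ n))
  Sat (cass A a)   m = conc A (ind a) (mon m)
  Sat (rass R a b) m = role R (ind a) (ind b) (mon m)

  Model : Ontology → Set ℓ
  Model O = ∀ {x} → x ∈ O → Sat (proj₁ x) (annot (proj₂ x))

_⊨_∶_ : Ontology → Axiom → Mon → Set₁
O ⊨ α ∶ m = (S : Structure 0ℓ) → MonLaw S → Sem.Model S O → Sem.Sat S α m

Star : Ontology → Set₁
Star O = ∀ R B n → O ⊨ ran R B ∶ n →
         Σ Annot λ v → ((ran R B , v) ∈ O) × ([ annot v ] ≡ [ n ])

elem : ℕ → List ℕ → Bool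
elem x = any (x ≡ᵇ_)

indsAx : Axiom → List IndName
indsAx (cass A a)   = a ∷ []
indsAx (rass R a b) = a ∷ b ∷ []
indsAx _            = []

rolsC : Concept → List RoleName
rolsC (atom A)  = []
rolsC top       = []
rolsC (ex R C)  = R ∷ rolsC C
rolsC (and C D) = rolsC C ++ rolsC D

rolsAx : Axiom → List RoleName
rolsAx (gci C (atomR A)) = rolsC C
rolsAx (gci C (exR R))   = R ∷ rolsC C
rolsAx (rinc R S)        = R ∷ S ∷ []
rolsAx (ran R A)         = R ∷ []
rolsAx (cass A a)        = []
rolsAx (rass R a b)      = R ∷ []

Ind : Ontology → List IndName
Ind = concatMap (λ x → indsAx (proj₁ x))

Rol : Ontology → List RoleName
Rol = concatMap (λ x → rolsAx (proj₁ x))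

Vars : Ontology → List Var
Vars = mapMaybe proj₂

InM : Ontology → NM → Set
InM O r = T (all (λ x → elem x (Vars O)) (proj₁ r))

module Canonical (O : Ontology) where

  IndO : Set
  IndO = Σ IndName λ a → T (elem a (Ind O))

  -- Aux(O) = { d^m_R | R ∈ Rol(O), m ∈ M(O) }
  AuxO : Set
  AuxO = (Σ RoleName λ R → T (elem R (Rol O))) × (Σ NM λ r → InM O r)

  Dom : Set
  Dom = IndO ⊎ AuxO

  IsAux : RoleName → NM → Dom → Set
  IsAux R r (inj₁ _)                 = ⊥
  IsAux R r (inj₂ ((R′ , _) , (r′ , _))) = (R′ ≡ R) × (r′ ≡ r)

  record Stage : Set₂ where
    field
      C  : ConceptName → Dom → NM → Set₁
      Rl : RoleName → Dom → Dom → NM → Set₁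

  structOf : (IndName → Dom) → Stage → Structure (lsuc 0ℓ)
  structOf ι st = record { Δ = Dom ; Δm = NM ; ind = ι ; mon = [_]
                         ; conc = Stage.C st ; role = Stage.Rl st }

  stage0 : Stage
  stage0 = record { C = c0 ; Rl = r0 }
    where
      c0 : ConceptName → Dom → NM → Set₁
      c0 A (inj₁ (a , _)) μ = Σ Mon λ m → (μ ≡ [ m ]) × (O ⊨ cass A a ∶ m)
      c0 A (inj₂ _)       μ = Lift (lsuc 0ℓ) ⊥
      r0 : RoleName → Dom → Dom → NM → Set₁
      r0 R (inj₁ (a , _)) (inj₁ (b , _)) μ = Σ Mon λ m → (μ ≡ [ m ]) × (O ⊨ rass R a b ∶ m)
      r0 R _ _ μ = Lift (lsuc 0ℓ) ⊥

  -- a step: choice of an annotated axiom of O (by position) together with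
  -- the elements d, d′ and the representative n the rule is applied to
  Step : Set
  Step = Fin (length O) × Dom × Dom × NM

  Premise : (IndName → Dom) → Stage → Step → Set₁
  Premise ι st (k , d , d′ , n) = InM O n × prem (proj₁ (lookup O k))
    where
      open Sem (structOf ι st)
      prem : Axiom → Set₁
      prem (gci C _)    = ⟦ C ⟧ d n
      prem (ran R _)    = ranSem R d n
      prem (rinc R _)   = Stage.Rl st R d d′ n
      prem (cass _ _)   = Lift (lsuc 0ℓ) ⊥
      prem (rass _ _ _) = Lift (lsuc 0ℓ) ⊥

  AddC : Step → ConceptName → Dom → NM → Set
  AddC (k , d , d′ , n) A e μ = add (lookup O k)
    where
      add : Axiom × Annot → Set
      add (gci _ (atomR B) , v) = (B ≡ A) × (e ≡ d) × (μ ≡ [ annot v ⊗ proj₁ n ])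
      add (ran _ B , v)         = (B ≡ A) × (e ≡ d) × (μ ≡ [ annot v ⊗ proj₁ n ])
      add _                     = ⊥

  AddR : Step → RoleName → Dom → Dom → NM → Set
  AddR (k , d , d′ , n) R e f μ = add (lookup O k)
    where
      add : Axiom × Annot → Set
      add (gci _ (exR S) , v) = (S ≡ R) × (e ≡ d)
                                × IsAux S [ annot v ⊗ proj₁ n ] f
                                × (μ ≡ [ annot v ⊗ proj₁ n ])
      add (rinc _ S , v)      = (S ≡ R) × (e ≡ d) × (f ≡ d′)
                                × (μ ≡ [ annot v ⊗ proj₁ n ])
      add _                   = ⊥

  stage : (IndName → Dom) → (ℕ → Step) → ℕ → Stage
  stage ι s zero    = stage0
  stage ι s (suc i) = record
    { C  = λ A d μ → Stage.C (stage ι s i) A d μ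
                     ⊎ (Premise ι (stage ι s i) (s i) × Lift (lsuc 0ℓ) (AddC (s i) A d μ))
    ; Rl = λ R d e μ → Stage.Rl (stage ι s i) R d e μ
                     ⊎ (Premise ι (stage ι s i) (s i) × Lift (lsuc 0ℓ) (AddR (s i) R d e μ))
    }

  Done : Stage → Step → Set₁
  Done st t = (∀ A d μ → AddC t A d μ → Stage.C st A d μ)
            × (∀ R d e μ → AddR t R d e μ → Stage.Rl st R d e μ)

  Fair : (IndName → Dom) → (ℕ → Step) → Set₁
  Fair ι s = ∀ i t → Premise ι (stage ι s i) t → ∃ λ j → Done (stage ι s j) t

  canon : (IndName → Dom) → (ℕ → Step) → Structure (lsuc 0ℓ)
  canon ι s = record
    { Δ = Dom ; Δm = NM ; ind = ι ; mon = [_]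
    ; conc = λ A d μ → Σ ℕ λ i → Stage.C (stage ι s i) A d μ
    ; role = λ R d e μ → Σ ℕ λ i → Stage.Rl (stage ι s i) R d e μ
    }

-- Each rule R1–R3 is the satisfaction condition of one axiom shape read as a
-- closure rule, so the argument is that I_O is closed under the rules.  A
-- premise true in I_O already holds at a single stage, since concept
-- semantics is monotone in the growing stages; fairness then fires the rule
-- and its conclusion holds at a later stage, with [ m × [ n ] ] = [ m × n ].
-- The rules only fire on representatives in M(O), which is harmless because
-- every monomial occurring in any stage is over the variables of O.  The
-- monomial law is uniqueness of strictly increasing representatives.

module Submission where

open import Defs
open import Data.Bool using (T; true; false)
open import Data.Bool.Properties using (T-irrelevant; T-≡)
open import Data.Nat using (ℕ; zero; suc; _<_; _<ᵇ_; _≡ᵇ_; _≤′_; ≤′-refl; ≤′-step; _⊔_)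
open import Data.Nat.Properties using (≡ᵇ⇒≡; ≡⇒≡ᵇ; ≤⇒≤′; m≤m⊔n; m≤n⊔m; <ᵇ⇒<; <-trans; <-irrefl; <-asym)
open import Data.List using (List; []; _∷_; _++_; lookup; concatMap)
open import Data.Maybe using (just)
import Data.Maybe.Relation.Unary.Any as Maybe
open import Data.List.Relation.Unary.Any as Any using (here; there; index)
open import Data.List.Relation.Unary.Any.Properties using (any⁺; any⁻; lookup-index; map⁺; mapMaybe⁺)
open import Data.List.Relation.Unary.All as All using (All)
open import Data.List.Relation.Unary.All.Properties using (all⁺; all⁻)
open import Data.List.Membership.Propositional using (_∈_; lose)
open import Data.List.Membership.Propositional.Properties using (++-∈⇔; ∈-++⁻; ∈-concatMap⁺; ∈-lookup)
open import Data.List.Relation.Binary.Subset.Propositional using (_⊆_)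
open import Data.Product using (_×_; _,_; proj₁; proj₂; ∃)
open import Level using (0ℓ; lift) renaming (suc to lsuc)
open import Data.Unit using (tt)
open import Data.Sum using (_⊎_; inj₁; inj₂; [_,_]′)
import Data.Sum as Sum
open import Data.Empty using (⊥-elim)
open import Function using (_∘_; id)
open import Function.Bundles using (_⇔_; mk⇔; Equivalence)
open import Function.Construct.Composition using (_⇔-∘_)
open import Function.Construct.Symmetry using (⇔-sym)
open import Relation.Binary.PropositionalEquality using (_≡_; refl; sym; cong; cong₂; subst; subst₂)

open Equivalence using (to; from)

x∈ins : ∀ x l → x ∈ ins x l
x∈ins x []      = here refl
x∈ins x (y ∷ r) with x <ᵇ y | x ≡ᵇ y in x≡ᵇy
... | true  | _     = here refl
... | false | true  = here (≡ᵇ⇒≡ x y (from T-≡ x≡ᵇy))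
... | false | false = there (x∈ins x r)

∈-ins⁺ : ∀ x {z} l → z ∈ l → z ∈ ins x l
∈-ins⁺ x (y ∷ r) z∈ with x <ᵇ y | x ≡ᵇ y | z∈
... | true  | _     | z∈l      = there z∈l
... | false | true  | z∈l      = z∈l
... | false | false | here z≡y  = here z≡y
... | false | false | there z∈r = there (∈-ins⁺ x r z∈r)

∈-ins⁻ : ∀ x {z} l → z ∈ ins x l → z ≡ x ⊎ z ∈ l
∈-ins⁻ x []      (here z≡x) = inj₁ z≡x
∈-ins⁻ x (y ∷ r) z∈ with x <ᵇ y | x ≡ᵇ y | z∈
... | true  | _     | here z≡x  = inj₁ z≡x
... | true  | _     | there z∈l = inj₂ z∈l
... | false | true  | z∈l       = inj₂ z∈l
... | false | false | here z≡y  = inj₂ (here z≡y)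
... | false | false | there z∈ins = Sum.map₂ there (∈-ins⁻ x r z∈ins)

norm-≈ : ∀ m → norm m ≈ₘ m
norm-≈ m z = mk⇔ (∈-norm⁻ m) (∈-norm⁺ m)
  where
    ∈-norm⁺ : ∀ m → z ∈ m → z ∈ norm m
    ∈-norm⁺ (x ∷ m) (here refl) = x∈ins z (norm m)
    ∈-norm⁺ (x ∷ m) (there z∈m) = ∈-ins⁺ x (norm m) (∈-norm⁺ m z∈m)
    ∈-norm⁻ : ∀ m → z ∈ norm m → z ∈ m
    ∈-norm⁻ (x ∷ m) z∈ = [ here , there ∘ ∈-norm⁻ m ]′ (∈-ins⁻ x (norm m) z∈)

≈ₘ-sym : ∀ {m n} → m ≈ₘ n → n ≈ₘ m
≈ₘ-sym m≈n z = ⇔-sym (m≈n z)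

≈ₘ-trans : ∀ {m n k} → m ≈ₘ n → n ≈ₘ k → m ≈ₘ k
≈ₘ-trans m≈n n≈k z = n≈k z ⇔-∘ m≈n z

⊗-congˡ : ∀ a {n n′} → n ≈ₘ n′ → (a ⊗ n) ≈ₘ (a ⊗ n′)
⊗-congˡ a n≈n′ z =
  ⇔-sym ++-∈⇔ ⇔-∘ (mk⇔ (Sum.map₂ (to (n≈n′ z))) (Sum.map₂ (from (n≈n′ z))) ⇔-∘ ++-∈⇔)

isCanon-tail : ∀ x l → T (isCanon (x ∷ l)) → T (isCanon l)
isCanon-tail x []      _ = _
isCanon-tail x (y ∷ l) c with x <ᵇ y
... | true = c

isCanon-head< : ∀ x l → T (isCanon (x ∷ l)) → ∀ {z} → z ∈ l → x < z
isCanon-head< x (y ∷ l) c z∈ with x <ᵇ y in x<ᵇy | z∈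
... | true | here refl = <ᵇ⇒< x y (from T-≡ x<ᵇy)
... | true | there z∈l = <-trans (<ᵇ⇒< x y (from T-≡ x<ᵇy)) (isCanon-head< y l c z∈l)

isCanon-≈⇒≡ : ∀ l₁ l₂ → T (isCanon l₁) → T (isCanon l₂) → l₁ ≈ₘ l₂ → l₁ ≡ l₂
isCanon-≈⇒≡ []       []       _  _  _     = refl
isCanon-≈⇒≡ []       (y ∷ l₂) _  _  l₁≈l₂ with from (l₁≈l₂ y) (here refl)
... | ()
isCanon-≈⇒≡ (x ∷ l₁) []       _  _  l₁≈l₂ with to (l₁≈l₂ x) (here refl)
... | ()
isCanon-≈⇒≡ (x ∷ l₁) (y ∷ l₂) c₁ c₂ l₁≈l₂ =
  cong₂ _∷_ x≡y (isCanon-≈⇒≡ l₁ l₂ (isCanon-tail x l₁ c₁) (isCanon-tail y l₂ c₂) tails≈)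
  where
    x≡y : x ≡ y
    x≡y with to (l₁≈l₂ x) (here refl) | from (l₁≈l₂ y) (here refl)
    ... | here x≡y  | _         = x≡y
    ... | there x∈l₂ | here y≡x = sym y≡x
    ... | there x∈l₂ | there y∈l₁ =
      ⊥-elim (<-asym (isCanon-head< y l₂ c₂ x∈l₂) (isCanon-head< x l₁ c₁ y∈l₁))
    tails≈ : l₁ ≈ₘ l₂
    tails≈ z = mk⇔ (drop x≡y (to (l₁≈l₂ z)) (isCanon-head< x l₁ c₁))
                   (drop (sym x≡y) (from (l₁≈l₂ z)) (isCanon-head< y l₂ c₂))
      where
        drop : ∀ {u v k k′} → u ≡ v → (z ∈ u ∷ k → z ∈ v ∷ k′)
             → (∀ {w} → w ∈ k → u < w) → z ∈ k → z ∈ k′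
        drop u≡v f head< z∈k with f (there z∈k)
        ... | here refl  = ⊥-elim (<-irrefl u≡v (head< z∈k))
        ... | there z∈k′ = z∈k′

NM-≡ : ∀ {r r′ : NM} → proj₁ r ≡ proj₁ r′ → r ≡ r′
NM-≡ {l , c} {.l , c′} refl = cong (l ,_) (T-irrelevant c c′)

[]-injective-≈ : ∀ m n → [ m ] ≡ [ n ] → m ≈ₘ n
[]-injective-≈ m n [m]≡[n] = ≈ₘ-trans (≈ₘ-sym (norm-≈ m))
  (subst (λ l → l ≈ₘ n) (sym (cong proj₁ [m]≡[n])) (norm-≈ n))

[]-cong : ∀ m n → m ≈ₘ n → [ m ] ≡ [ n ]
[]-cong m n m≈n = NM-≡ (isCanon-≈⇒≡ (norm m) (norm n) (normCanon m) (normCanon n)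
  (≈ₘ-trans (norm-≈ m) (≈ₘ-trans m≈n (≈ₘ-sym (norm-≈ n)))))

[]-monLaw : ∀ m n → ([ m ] ≡ [ n ]) ⇔ (m ≈ₘ n)
[]-monLaw m n = mk⇔ ([]-injective-≈ m n) ([]-cong m n)

[]-repr : ∀ (r : NM) → [ proj₁ r ] ≡ r
[]-repr (l , c) = NM-≡ (isCanon-≈⇒≡ (norm l) l (normCanon l) c (norm-≈ l))

[⊗norm] : ∀ a n → [ a ⊗ norm n ] ≡ [ a ⊗ n ]
[⊗norm] a n = []-cong _ _ (⊗-congˡ a (norm-≈ n))

∈⇒elem : ∀ {x l} → x ∈ l → T (elem x l)
∈⇒elem {x} x∈l = any⁺ _ (Any.map (λ { refl → ≡⇒≡ᵇ x x refl }) x∈l)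

elem⇒∈ : ∀ {x} l → T (elem x l) → x ∈ l
elem⇒∈ {x} l x∈l = Any.map (≡ᵇ⇒≡ x _) (any⁻ _ l x∈l)

elem-concatMap : ∀ {A : Set} (f : A → List ℕ) {xs a y}
               → a ∈ xs → y ∈ f a → T (elem y (concatMap f xs))
elem-concatMap f a∈xs y∈fa = ∈⇒elem (∈-concatMap⁺ f (lose a∈xs y∈fa))

++-⊆ : ∀ {A : Set} {xs ys zs : List A} → xs ⊆ zs → ys ⊆ zs → xs ++ ys ⊆ zs
++-⊆ {xs = xs} xs⊆zs ys⊆zs = [ xs⊆zs , ys⊆zs ]′ ∘ ∈-++⁻ xs

reprStructure : ∀ {ℓ} {Δ : Set} → (IndName → Δ) → (ConceptName → Δ → NM → Set ℓ)
              → (RoleName → Δ → Δ → NM → Set ℓ) → Structure ℓ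
reprStructure {Δ = Δ} ind conc role = record
  { Δ = Δ ; Δm = NM ; ind = ind ; mon = [_] ; conc = conc ; role = role }

module _ (O : Ontology) where

  InM⇒⊆ : ∀ {r} → InM O r → proj₁ r ⊆ Vars O
  InM⇒⊆ {l , _} r∈M = elem⇒∈ (Vars O) ∘ All.lookup (all⁺ _ l r∈M)

  ⊆⇒InM : ∀ {r} → proj₁ r ⊆ Vars O → InM O r
  ⊆⇒InM r⊆V = all⁻ _ (All.tabulate (∈⇒elem ∘ r⊆V))

  InM-[] : ∀ {m} → m ⊆ Vars O → InM O [ m ]
  InM-[] {m} m⊆V = ⊆⇒InM {[ m ]} (m⊆V ∘ to (norm-≈ m _))

  InM-[]⁻ : ∀ {m} → InM O [ m ] → m ⊆ Vars O
  InM-[]⁻ {m} [m]∈M = InM⇒⊆ {[ m ]} [m]∈M ∘ from (norm-≈ m _)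

  InM-⊗ : ∀ {m n} → InM O [ m ] → InM O [ n ] → InM O [ m ⊗ n ]
  InM-⊗ {m} {n} [m]∈M [n]∈M = InM-[] {m ⊗ n} (++-⊆ (InM-[]⁻ {m} [m]∈M) (InM-[]⁻ {n} [n]∈M))

  annot-⊆ : ∀ {α v} → (α , v) ∈ O → annot v ⊆ Vars O
  annot-⊆ {v = just x} α∈O (here refl) =
    mapMaybe⁺ proj₂ O (map⁺ (Any.map (λ { refl → Maybe.just refl }) α∈O))

  InM-annot-⊗ : ∀ {α v} m → (α , v) ∈ O → InM O [ m ] → InM O [ annot v ⊗ m ]
  InM-annot-⊗ {v = v} m α∈O = InM-⊗ {annot v} {m} (InM-[] (annot-⊆ α∈O))

  InM-repr : ∀ r → InM O r → InM O [ proj₁ r ]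
  InM-repr r r∈M = subst (InM O) (sym ([]-repr r)) r∈M

  ⟦⟧-InM : ∀ {ℓ} {Δ : Set} (ind : IndName → Δ)
             {conc : ConceptName → Δ → NM → Set ℓ} {role : RoleName → Δ → Δ → NM → Set ℓ}
         → (∀ {A d μ} → conc A d μ → InM O μ) → (∀ {R d e μ} → role R d e μ → InM O μ)
         → ∀ C {d μ} → Sem.⟦_⟧ (reprStructure ind conc role) C d μ → InM O μ
  ⟦⟧-InM ind conc∈M role∈M (atom A) h = conc∈M h
  ⟦⟧-InM ind conc∈M role∈M top (lift refl) = tt
  ⟦⟧-InM ind conc∈M role∈M (and C D) (m , n , hC , hD , lift refl) =
    InM-⊗ {m} {n} (⟦⟧-InM ind conc∈M role∈M C hC) (⟦⟧-InM ind conc∈M role∈M D hD)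
  ⟦⟧-InM ind conc∈M role∈M (ex R C) (e , m , n , hR , hC , lift refl) =
    InM-⊗ {m} {n} (role∈M hR) (⟦⟧-InM ind conc∈M role∈M C hC)

  -- A model of O on one point in which facts hold exactly for monomials in
  -- M(O); hence everything O entails, in particular the initial stage, is in M(O).
  varsModel : Structure 0ℓ
  varsModel = reprStructure (λ _ → tt) (λ _ _ → InM O) (λ _ _ _ → InM O)

  varsModel-model : Sem.Model varsModel O
  varsModel-model {gci C (atomR B) , v} α∈O d n h = InM-annot-⊗ n α∈O (⟦⟧-InM _ id id C h)
  varsModel-model {gci C (exR R)   , v} α∈O d n h =
    tt , InM-annot-⊗ n α∈O (⟦⟧-InM _ id id C h)
  varsModel-model {rinc R S        , v} α∈O d e n h = InM-annot-⊗ n α∈O h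
  varsModel-model {ran R B         , v} α∈O e n (d , h) = InM-annot-⊗ n α∈O h
  varsModel-model {cass A a        , v} α∈O = InM-[] (annot-⊆ α∈O)
  varsModel-model {rass R a b      , v} α∈O = InM-[] (annot-⊆ α∈O)

  Ind-∈ : ∀ {α v a} → (α , v) ∈ O → a ∈ indsAx α → T (elem a (Ind O))
  Ind-∈ = elem-concatMap (indsAx ∘ proj₁)

  Rol-∈ : ∀ {α v R} → (α , v) ∈ O → R ∈ rolsAx α → T (elem R (Rol O))
  Rol-∈ = elem-concatMap (rolsAx ∘ proj₁)

  ∈⇒⊨ : ∀ {α v} → (α , v) ∈ O → O ⊨ α ∶ annot v
  ∈⇒⊨ α∈O _ _ model = model α∈O

module _ (O : Ontology) (ι : IndName → Canonical.Dom O) (s : ℕ → Canonical.Step O) where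
  open Canonical O

  ⟦_⟧ˢ : Concept → Stage → Dom → NM → Set₁
  ⟦ C ⟧ˢ st = Sem.⟦_⟧ (structOf ι st) C

  _⊑_ : Stage → Stage → Set₁
  st ⊑ st′ = (∀ {A d μ} → Stage.C st A d μ → Stage.C st′ A d μ)
           × (∀ {R d e μ} → Stage.Rl st R d e μ → Stage.Rl st′ R d e μ)

  ⟦⟧-mono : ∀ {st st′} → st ⊑ st′ → ∀ C {d μ} → ⟦ C ⟧ˢ st d μ → ⟦ C ⟧ˢ st′ d μ
  ⟦⟧-mono st⊑st′ (atom A)  h = proj₁ st⊑st′ h
  ⟦⟧-mono st⊑st′ top       h = h
  ⟦⟧-mono st⊑st′ (and C D) (m , n , hC , hD , eq) =
    m , n , ⟦⟧-mono st⊑st′ C hC , ⟦⟧-mono st⊑st′ D hD , eq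
  ⟦⟧-mono st⊑st′ (ex R C)  (e , m , n , hR , hC , eq) =
    e , m , n , proj₂ st⊑st′ hR , ⟦⟧-mono st⊑st′ C hC , eq

  stage-mono : ∀ {i j} → i ≤′ j → stage ι s i ⊑ stage ι s j
  stage-mono ≤′-refl        = id , id
  stage-mono (≤′-step i≤′j) = inj₁ ∘ proj₁ (stage-mono i≤′j) , inj₁ ∘ proj₂ (stage-mono i≤′j)

  AddC-InM : ∀ ((k , d , d′ , n) : Step) {A e μ}
           → InM O n → AddC (k , d , d′ , n) A e μ → InM O μ
  AddC-InM (k , _ , _ , n) n∈M added with lookup O k | ∈-lookup {xs = O} k | added
  ... | gci _ (atomR _) , _ | α∈O | _ , _ , refl = InM-annot-⊗ O (proj₁ n) α∈O (InM-repr O n n∈M)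
  ... | ran _ _         , _ | α∈O | _ , _ , refl = InM-annot-⊗ O (proj₁ n) α∈O (InM-repr O n n∈M)
  ... | gci _ (exR _)   , _ | _ | ()
  ... | rinc _ _        , _ | _ | ()
  ... | cass _ _        , _ | _ | ()
  ... | rass _ _ _      , _ | _ | ()

  AddR-InM : ∀ ((k , d , d′ , n) : Step) {R e f μ}
           → InM O n → AddR (k , d , d′ , n) R e f μ → InM O μ
  AddR-InM (k , _ , _ , n) n∈M added with lookup O k | ∈-lookup {xs = O} k | added
  ... | gci _ (exR _)   , _ | α∈O | _ , _ , _ , refl = InM-annot-⊗ O (proj₁ n) α∈O (InM-repr O n n∈M)
  ... | rinc _ _        , _ | α∈O | _ , _ , _ , refl = InM-annot-⊗ O (proj₁ n) α∈O (InM-repr O n n∈M)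
  ... | gci _ (atomR _) , _ | _ | ()
  ... | ran _ _         , _ | _ | ()
  ... | cass _ _        , _ | _ | ()
  ... | rass _ _ _      , _ | _ | ()

  stage-C-InM : ∀ i {A d μ} → Stage.C (stage ι s i) A d μ → InM O μ
  stage-C-InM zero    {d = inj₁ _} (m , refl , ⊨A) =
    ⊨A (varsModel O) []-monLaw (varsModel-model O)
  stage-C-InM zero    {d = inj₂ _} (lift ())
  stage-C-InM (suc i) (inj₁ h) = stage-C-InM i h
  stage-C-InM (suc i) (inj₂ ((n∈M , _) , lift added)) = AddC-InM (s i) n∈M added

  stage-Rl-InM : ∀ i {R d e μ} → Stage.Rl (stage ι s i) R d e μ → InM O μ
  stage-Rl-InM zero    {d = inj₁ _} {inj₁ _} (m , refl , ⊨R) =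
    ⊨R (varsModel O) []-monLaw (varsModel-model O)
  stage-Rl-InM zero    {d = inj₁ _} {inj₂ _} (lift ())
  stage-Rl-InM zero    {d = inj₂ _} (lift ())
  stage-Rl-InM (suc i) (inj₁ h) = stage-Rl-InM i h
  stage-Rl-InM (suc i) (inj₂ ((n∈M , _) , lift added)) = AddR-InM (s i) n∈M added

  ⟦⟧ˢ-InM : ∀ i C {d μ} → ⟦ C ⟧ˢ (stage ι s i) d μ → InM O μ
  ⟦⟧ˢ-InM i = ⟦⟧-InM O ι (stage-C-InM i) (stage-Rl-InM i)

  I : Structure (lsuc 0ℓ)
  I = canon ι s

  stage-⊔ˡ : ∀ i j → stage ι s i ⊑ stage ι s (i ⊔ j)
  stage-⊔ˡ i j = stage-mono (≤⇒≤′ (m≤m⊔n i j))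

  stage-⊔ʳ : ∀ i j → stage ι s j ⊑ stage ι s (i ⊔ j)
  stage-⊔ʳ i j = stage-mono (≤⇒≤′ (m≤n⊔m i j))

  ⟦⟧-canon⇒stage : ∀ C {d μ} → Sem.⟦_⟧ I C d μ → ∃ λ i → ⟦ C ⟧ˢ (stage ι s i) d μ
  ⟦⟧-canon⇒stage (atom A)  h = h
  ⟦⟧-canon⇒stage top       h = zero , h
  ⟦⟧-canon⇒stage (and C D) (m , n , hC , hD , eq)
    with ⟦⟧-canon⇒stage C hC | ⟦⟧-canon⇒stage D hD
  ... | i , hCᵢ | j , hDⱼ =
    i ⊔ j , m , n , ⟦⟧-mono (stage-⊔ˡ i j) C hCᵢ , ⟦⟧-mono (stage-⊔ʳ i j) D hDⱼ , eq
  ⟦⟧-canon⇒stage (ex R C)  (e , m , n , (i , hRᵢ) , hC , eq) with ⟦⟧-canon⇒stage C hC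
  ... | j , hCⱼ = i ⊔ j , e , m , n , proj₂ (stage-⊔ˡ i j) hRᵢ , ⟦⟧-mono (stage-⊔ʳ i j) C hCⱼ , eq

  module _ (fair : Fair ι s) (ι-Ind : ∀ a (a∈O : T (elem a (Ind O))) → ι a ≡ inj₁ (a , a∈O)) where

    -- Abstracting lookup O (index α∈O) makes the premise and the additions of
    -- the step that applies the axiom α compute.
    sat-gci-atom : ∀ {C B v} → (gci C (atomR B) , v) ∈ O → Sem.Sat I (gci C (atomR B)) (annot v)
    sat-gci-atom {C} {B} {v} α∈O d m h with ⟦⟧-canon⇒stage C h
    ... | i , hᵢ with lookup O (index α∈O) | lookup-index α∈O | fair i (index α∈O , d , d , [ m ])
    ... | _ | refl | fire with fire (⟦⟧ˢ-InM i C hᵢ , hᵢ)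
    ... | j , added , _ =
      j , subst (Stage.C (stage ι s j) B d) ([⊗norm] (annot v) m) (added _ _ _ (refl , refl , refl))

    sat-gci-exists : ∀ {C R v} → (gci C (exR R) , v) ∈ O → Sem.Sat I (gci C (exR R)) (annot v)
    sat-gci-exists {C} {R} {v} α∈O d m h with ⟦⟧-canon⇒stage C h
    ... | i , hᵢ with lookup O (index α∈O) | lookup-index α∈O | fair i (index α∈O , d , d , [ m ])
    ... | _ | refl | fire with fire (⟦⟧ˢ-InM i C hᵢ , hᵢ)
    ... | j , _ , added =
      inj₂ ((R , R∈O) , (_ , InM-annot-⊗ O (proj₁ [ m ]) α∈O (InM-repr O [ m ] (⟦⟧ˢ-InM i C hᵢ)))) ,
      j , subst (Stage.Rl (stage ι s j) R d _) ([⊗norm] (annot v) m)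
                (added _ _ _ _ (refl , refl , (refl , refl) , refl))
      where
        R∈O : T (elem R (Rol O))
        R∈O = Rol-∈ O α∈O (here refl)

    sat-rinc : ∀ {R S v} → (rinc R S , v) ∈ O → Sem.Sat I (rinc R S) (annot v)
    sat-rinc {R} {S} {v} α∈O d e m (i , hᵢ)
      with lookup O (index α∈O) | lookup-index α∈O | fair i (index α∈O , d , e , [ m ])
    ... | _ | refl | fire with fire (stage-Rl-InM i hᵢ , hᵢ)
    ... | j , _ , added =
      j , subst (Stage.Rl (stage ι s j) S d e) ([⊗norm] (annot v) m)
                (added _ _ _ _ (refl , refl , refl , refl))

    sat-ran : ∀ {R B v} → (ran R B , v) ∈ O → Sem.Sat I (ran R B) (annot v)
    sat-ran {R} {B} {v} α∈O e m (d , i , hᵢ)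
      with lookup O (index α∈O) | lookup-index α∈O | fair i (index α∈O , e , e , [ m ])
    ... | _ | refl | fire with fire (stage-Rl-InM i hᵢ , d , hᵢ)
    ... | j , added , _ =
      j , subst (Stage.C (stage ι s j) B e) ([⊗norm] (annot v) m) (added _ _ _ (refl , refl , refl))

    sat-cass : ∀ {A a v} → (cass A a , v) ∈ O → Sem.Sat I (cass A a) (annot v)
    sat-cass {A} {a} {v} α∈O = zero ,
      subst (λ d → Stage.C stage0 A d [ annot v ]) (sym (ι-Ind a (Ind-∈ O α∈O (here refl))))
            (annot v , refl , ∈⇒⊨ O α∈O)

    sat-rass : ∀ {R a b v} → (rass R a b , v) ∈ O → Sem.Sat I (rass R a b) (annot v)
    sat-rass {R} {a} {b} {v} α∈O = zero ,
      subst₂ (λ d e → Stage.Rl stage0 R d e [ annot v ])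
             (sym (ι-Ind a (Ind-∈ O α∈O (here refl))))
             (sym (ι-Ind b (Ind-∈ O α∈O (there (here refl)))))
             (annot v , refl , ∈⇒⊨ O α∈O)

    canon-model : Sem.Model I O
    canon-model {gci C (atomR B) , v} = sat-gci-atom
    canon-model {gci C (exR R)   , v} = sat-gci-exists
    canon-model {rinc R S        , v} = sat-rinc
    canon-model {ran R B         , v} = sat-ran
    canon-model {cass A a        , v} = sat-cass
    canon-model {rass R a b      , v} = sat-rass

proposition2 : (O : Ontology) → NormalForm O → Star O
    → (ι : IndName → Canonical.Dom O)
    → (∀ a (p : T (elem a (Ind O))) → ι a ≡ inj₁ (a , p))
    → (s : ℕ → Canonical.Step O) → Canonical.Fair O ι s
    → MonLaw (Canonical.canon O ι s) × Sem.Model (Canonical.canon O ι s) O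
proposition2 O _ _ ι ι-Ind s fair = []-monLaw , canon-model O ι s fair ι-Ind
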